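{- Let $\mathcal{M}=(W,\leq,R,V)$ be any model based on a forward and downward confluent frame. Let $\Vdash$ be the local forcing relation, and let $\Vdash_{FS}$ and $\Vdash_{W}$ be the relations defined like $\Vdash$ except that: for $\Vdash_{FS}$, $x\Vdash_{FS}\square A$ iff for all $x'\geq x$ and all $y$ with $Rx'y$, $y\Vdash_{FS}A$ (with $\lozenge$ interpreted locally: $x\Vdash_{FS}\lozenge A$ iff there is $y$ with $Rxy$ and $y\Vdash_{FS}A$); for $\Vdash_{W}$, $x\Vdash_W\square A$ iff for all $x'\geq x$ and all $y$ with $Rx'y$, $y\Vdash_W A$, and $x\Vdash_W\lozenge A$ iff for all $x'\geq x$ there is $y$ with $Rx'y$ and $y\Vdash_W A$. Then for every $x\in W$ and every formula $A$: $x\Vdash A$ iff $x\Vdash_{FS}A$ iff $x\Vdash_W A$.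
   Context: Formulas are built from a set $\mathbf{At}$ of atoms by $A::=p\mid A\supset A\mid \top\mid\bot\mid A\vee A\mid A\wedge A\mid \square A\mid \lozenge A$. A frame is $(W,\leq,R)$ with $W$ nonempty, $\leq$ a preorder and $R$ a binary relation on $W$. Forward confluent: for all $x,x',y$ with $x\leq x'$ and $Rxy$ there is $y'$ with $Rx'y'$ and $y\leq y'$. Downward confluent: for all $x,x',y$ with $x\leq x'$ and $Rx'y$ there is $z$ with $Rxz$ and $z\leq y$. A model adds $V:\mathbf{At}\to\wp(W)$ with each $V(p)$ $\leq$-upward closed. The (local) forcing relation $\Vdash$: $x\Vdash p$ iff $x\in V(p)$; $\top,\bot,\wedge,\vee$ pointwise; $x\Vdash A\supset B$ iff for all $x'\geq x$, $x'\Vdash A$ implies $x'\Vdash B$; $x\Vdash\square A$ iff for all $y$ with $Rxy$, $y\Vdash A$; $x\Vdash\lozenge A$ iff there is $y$ with $Rxy$ and $y\Vdash A$. The relations $\Vdash_{FS}$ and $\Vdash_W$ have the same clauses for atoms, $\top,\bot,\wedge,\vee,\supset$ and differ only in the modal clauses as stated. -}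

module Defs where

open import Data.Product using (Σ; _×_; _,_)
open import Data.Sum using (_⊎_)
open import Data.Unit using (⊤)
open import Data.Empty using (⊥)
open import Relation.Binary.Definitions using (Reflexive; Transitive)

data Form (At : Set) : Set where
  atom : At → Form At
  _⊃_  : Form At → Form At → Form At
  ⊤f   : Form At
  ⊥f   : Form At
  _∨f_ : Form At → Form At → Form At
  _∧f_ : Form At → Form At → Form At
  □_   : Form At → Form At
  ◇_   : Form At → Form At

record Frame : Set₁ where
  field
    W      : Set
    _≤_    : W → W → Set
    R      : W → W → Set
    ≤-refl  : Reflexive _≤_
    ≤-trans : Transitive _≤_

  ForwardConfluent : Set
  ForwardConfluent = ∀ {x x' y} → x ≤ x' → R x y → Σ W λ y' → R x' y' × (y ≤ y')

  DownwardConfluent : Set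
  DownwardConfluent = ∀ {x x' y} → x ≤ x' → R x' y → Σ W λ z → R x z × (z ≤ y)

record Model (At : Set) : Set₁ where
  field
    frame : Frame
  open Frame frame public
  field
    V       : At → W → Set
    V-upward : ∀ {p x x'} → x ≤ x' → V p x → V p x'

module _ {At : Set} (M : Model At) where
  open Model M

  _⊩_ : W → Form At → Set
  x ⊩ atom p  = V p x
  x ⊩ (A ⊃ B) = ∀ x' → x ≤ x' → x' ⊩ A → x' ⊩ B
  x ⊩ ⊤f      = ⊤
  x ⊩ ⊥f      = ⊥
  x ⊩ (A ∨f B) = (x ⊩ A) ⊎ (x ⊩ B)
  x ⊩ (A ∧f B) = (x ⊩ A) × (x ⊩ B)
  x ⊩ (□ A)   = ∀ y → R x y → y ⊩ A
  x ⊩ (◇ A)   = Σ W λ y → R x y × (y ⊩ A)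

  _⊩FS_ : W → Form At → Set
  x ⊩FS atom p  = V p x
  x ⊩FS (A ⊃ B) = ∀ x' → x ≤ x' → x' ⊩FS A → x' ⊩FS B
  x ⊩FS ⊤f      = ⊤
  x ⊩FS ⊥f      = ⊥
  x ⊩FS (A ∨f B) = (x ⊩FS A) ⊎ (x ⊩FS B)
  x ⊩FS (A ∧f B) = (x ⊩FS A) × (x ⊩FS B)
  x ⊩FS (□ A)   = ∀ x' → x ≤ x' → ∀ y → R x' y → y ⊩FS A
  x ⊩FS (◇ A)   = Σ W λ y → R x y × (y ⊩FS A)

  _⊩W_ : W → Form At → Set
  x ⊩W atom p  = V p x
  x ⊩W (A ⊃ B) = ∀ x' → x ≤ x' → x' ⊩W A → x' ⊩W B
  x ⊩W ⊤f      = ⊤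
  x ⊩W ⊥f      = ⊥
  x ⊩W (A ∨f B) = (x ⊩W A) ⊎ (x ⊩W B)
  x ⊩W (A ∧f B) = (x ⊩W A) × (x ⊩W B)
  x ⊩W (□ A)   = ∀ x' → x ≤ x' → ∀ y → R x' y → y ⊩W A
  x ⊩W (◇ A)   = ∀ x' → x ≤ x' → Σ W λ y → R x' y × (y ⊩W A)

-- Under forward and downward confluence local forcing is persistent along ≤:
-- downward confluence carries □ upwards and forward confluence carries ◇.
-- Hence the extra quantification over ≤-successors in the □ clauses of ⊩FS and
-- ⊩W, and in the ◇ clause of ⊩W, adds nothing, and each relation agrees with
-- local forcing by induction on formulas, run in both directions at once since
-- the antecedent of ⊃ reverses the direction.
module Submission where

open import Defs
open import Data.Product using (_×_; _,_; map₂)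
import Data.Sum as Sum
open import Function using (_∘_)
open import Function.Bundles using (_⇔_; mk⇔)

module ConfluentModel {At : Set} (M : Model At)
         (forward : Frame.ForwardConfluent (Model.frame M))
         (downward : Frame.DownwardConfluent (Model.frame M)) where
  open Model M

  ⊩-mono : ∀ A {x x'} → x ≤ x' → _⊩_ M x A → _⊩_ M x' A
  ⊩-mono (atom p)  x≤x' h = V-upward x≤x' h
  ⊩-mono (A ⊃ B)   x≤x' h = λ z x'≤z → h z (≤-trans x≤x' x'≤z)
  ⊩-mono ⊤f        x≤x' h = h
  ⊩-mono (A ∨f B)  x≤x' h = Sum.map (⊩-mono A x≤x') (⊩-mono B x≤x') h
  ⊩-mono (A ∧f B)  x≤x' (a , b) = ⊩-mono A x≤x' a , ⊩-mono B x≤x' b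
  ⊩-mono (□ A)     x≤x' h y Rx'y with downward x≤x' Rx'y
  ... | z , Rxz , z≤y = ⊩-mono A z≤y (h z Rxz)
  ⊩-mono (◇ A)     x≤x' (y , Rxy , a) with forward x≤x' Rxy
  ... | y' , Rx'y' , y≤y' = y' , Rx'y' , ⊩-mono A y≤y' a

  ⊩⇒⊩FS : ∀ A {x} → _⊩_ M x A → _⊩FS_ M x A
  ⊩FS⇒⊩ : ∀ A {x} → _⊩FS_ M x A → _⊩_ M x A
  ⊩⇒⊩FS (atom p) h = h
  ⊩⇒⊩FS (A ⊃ B)  h = λ z x≤z a → ⊩⇒⊩FS B (h z x≤z (⊩FS⇒⊩ A a))
  ⊩⇒⊩FS ⊤f       h = h
  ⊩⇒⊩FS (A ∨f B) h = Sum.map (⊩⇒⊩FS A) (⊩⇒⊩FS B) h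
  ⊩⇒⊩FS (A ∧f B) (a , b) = ⊩⇒⊩FS A a , ⊩⇒⊩FS B b
  ⊩⇒⊩FS (□ A)    h x' x≤x' y Rx'y = ⊩⇒⊩FS A (⊩-mono (□ A) x≤x' h y Rx'y)
  ⊩⇒⊩FS (◇ A)    h = map₂ (map₂ (⊩⇒⊩FS A)) h
  ⊩FS⇒⊩ (atom p) h = h
  ⊩FS⇒⊩ (A ⊃ B)  h = λ z x≤z a → ⊩FS⇒⊩ B (h z x≤z (⊩⇒⊩FS A a))
  ⊩FS⇒⊩ ⊤f       h = h
  ⊩FS⇒⊩ (A ∨f B) h = Sum.map (⊩FS⇒⊩ A) (⊩FS⇒⊩ B) h
  ⊩FS⇒⊩ (A ∧f B) (a , b) = ⊩FS⇒⊩ A a , ⊩FS⇒⊩ B b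
  ⊩FS⇒⊩ (□ A)    h y Rxy = ⊩FS⇒⊩ A (h _ ≤-refl y Rxy)
  ⊩FS⇒⊩ (◇ A)    h = map₂ (map₂ (⊩FS⇒⊩ A)) h

  ⊩⇒⊩W : ∀ A {x} → _⊩_ M x A → _⊩W_ M x A
  ⊩W⇒⊩ : ∀ A {x} → _⊩W_ M x A → _⊩_ M x A
  ⊩⇒⊩W (atom p) h = h
  ⊩⇒⊩W (A ⊃ B)  h = λ z x≤z a → ⊩⇒⊩W B (h z x≤z (⊩W⇒⊩ A a))
  ⊩⇒⊩W ⊤f       h = h
  ⊩⇒⊩W (A ∨f B) h = Sum.map (⊩⇒⊩W A) (⊩⇒⊩W B) h
  ⊩⇒⊩W (A ∧f B) (a , b) = ⊩⇒⊩W A a , ⊩⇒⊩W B b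
  ⊩⇒⊩W (□ A)    h x' x≤x' y Rx'y = ⊩⇒⊩W A (⊩-mono (□ A) x≤x' h y Rx'y)
  ⊩⇒⊩W (◇ A)    h x' x≤x' = map₂ (map₂ (⊩⇒⊩W A)) (⊩-mono (◇ A) x≤x' h)
  ⊩W⇒⊩ (atom p) h = h
  ⊩W⇒⊩ (A ⊃ B)  h = λ z x≤z a → ⊩W⇒⊩ B (h z x≤z (⊩⇒⊩W A a))
  ⊩W⇒⊩ ⊤f       h = h
  ⊩W⇒⊩ (A ∨f B) h = Sum.map (⊩W⇒⊩ A) (⊩W⇒⊩ B) h
  ⊩W⇒⊩ (A ∧f B) (a , b) = ⊩W⇒⊩ A a , ⊩W⇒⊩ B b
  ⊩W⇒⊩ (□ A)    h y Rxy = ⊩W⇒⊩ A (h _ ≤-refl y Rxy)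
  ⊩W⇒⊩ (◇ A)    h = map₂ (map₂ (⊩W⇒⊩ A)) (h _ ≤-refl)

proposition1 : {At : Set} (M : Model At) →
    Frame.ForwardConfluent (Model.frame M) →
    Frame.DownwardConfluent (Model.frame M) →
    ∀ (x : Model.W M) (A : Form At) →
      ((_⊩_ M x A) ⇔ (_⊩FS_ M x A)) × ((_⊩FS_ M x A) ⇔ (_⊩W_ M x A))
proposition1 M forward downward x A =
  mk⇔ (⊩⇒⊩FS A) (⊩FS⇒⊩ A) , mk⇔ (⊩⇒⊩W A ∘ ⊩FS⇒⊩ A) (⊩⇒⊩FS A ∘ ⊩W⇒⊩ A)
  where open ConfluentModel M forward downward
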